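{- Let $n \ge 1$ be a natural number and let $k \in \{1,\ldots,n\}$. Define the following closed terms of the untyped $\lambda$-calculus. For each $j = 1,\ldots,n$, let \[ M_j^n \equiv \lambda \phi_1 \cdots \phi_n x_1 \cdots x_n .\, \big(x_j\ (\phi_1\ x_1 \cdots x_n) \cdots (\phi_n\ x_1 \cdots x_n)\big). \] The $n$-ary generalization of Curry's fixed-point combinator is \[ \Phi_k^n \equiv \lambda f_1 \cdots f_n .\, \big(A_k\ A_1 \cdots A_n\big), \] where for each $j=1,\ldots,n$, \[ A_j \equiv \lambda x_1 \cdots x_n .\, \big(f_j\ (x_1\ x_1 \cdots x_n) \cdots (x_n\ x_1 \cdots x_n)\big). \] (Here the $A_j$ contain the variables $f_1,\ldots,f_n$ free, bound by the outer abstraction.) The $n$-ary generalization of Turing's fixed-point combinator is \[ \Psi_k^n \equiv \big(B_k\ B_1 \cdots B_n\big), \] where for each $j=1,\ldots,n$, \[ B_j \equiv \lambda x_1 \cdots x_n f_1 \cdots f_n .\, \big(f_j\ (x_1\ x_1 \cdots x_n\ f_1 \cdots f_n) \cdots (x_n\ x_1 \cdots x_n\ f_1 \cdots f_n)\big). \] Then \[ (\Phi_k^n\ M_1^n \cdots M_n^n) \twoheadrightarrow_{\beta\eta} \Psi_k^n, \] i.e., $(\Phi_k^n\ M_1^n \cdots M_n^n)$ reduces to $\Psi_k^n$ (up to $\alpha$-conversion) in zero or more $\beta\eta$-reduction steps.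
   Context: Terms are those of the untyped $\lambda$-calculus, with application associating to the left: $(P\ Q_1 \cdots Q_m)$ means $(\cdots((P\ Q_1)\ Q_2)\cdots Q_m)$. The notation $\lambda x_1 \cdots x_n . P$ abbreviates $\lambda x_1.\lambda x_2.\cdots\lambda x_n.P$. The relation $\twoheadrightarrow_{\beta\eta}$ is the reflexive and transitive closure of one-step $\beta\eta$-reduction, and terms are identified modulo $\alpha$-conversion. -}

module Defs where

open import Data.Nat using (ℕ; zero; suc; _+_)
open import Data.Fin using (Fin; zero; suc; opposite; _↑ˡ_; _↑ʳ_)
open import Data.List using (List; foldl; tabulate)
open import Relation.Binary.Construct.Closure.ReflexiveTransitive using (Star)

-- Untyped λ-terms, well-scoped de Bruijn representation
-- (terms are thereby identified modulo α-conversion).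

infixl 7 _·_

data Tm (n : ℕ) : Set where
  var : Fin n → Tm n
  ƛ   : Tm (suc n) → Tm n
  _·_ : Tm n → Tm n → Tm n

ext : ∀ {m n} → (Fin m → Fin n) → Fin (suc m) → Fin (suc n)
ext ρ zero    = zero
ext ρ (suc i) = suc (ρ i)

rename : ∀ {m n} → (Fin m → Fin n) → Tm m → Tm n
rename ρ (var i) = var (ρ i)
rename ρ (ƛ t)   = ƛ (rename (ext ρ) t)
rename ρ (t · u) = rename ρ t · rename ρ u

exts : ∀ {m n} → (Fin m → Tm n) → Fin (suc m) → Tm (suc n)
exts σ zero    = var zero
exts σ (suc i) = rename suc (σ i)

subst : ∀ {m n} → (Fin m → Tm n) → Tm m → Tm n
subst σ (var i) = σ i
subst σ (ƛ t)   = ƛ (subst (exts σ) t)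
subst σ (t · u) = subst σ t · subst σ u

_[_] : ∀ {n} → Tm (suc n) → Tm n → Tm n
t [ u ] = subst σ t
  where
  σ : _ → _
  σ zero    = u
  σ (suc i) = var i

infix 4 _⟶βη_ _↠βη_

data _⟶βη_ {n : ℕ} : Tm n → Tm n → Set where
  β    : ∀ (t : Tm (suc n)) (u : Tm n) → (ƛ t · u) ⟶βη (t [ u ])
  η    : ∀ (t : Tm n) → ƛ (rename suc t · var zero) ⟶βη t
  ξ-ƛ  : ∀ {t t' : Tm (suc n)} → t ⟶βη t' → ƛ t ⟶βη ƛ t'
  ξ-·ₗ : ∀ {t t' u : Tm n} → t ⟶βη t' → (t · u) ⟶βη (t' · u)
  ξ-·ᵣ : ∀ {t u u' : Tm n} → u ⟶βη u' → (t · u) ⟶βη (t · u')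

_↠βη_ : ∀ {n} → Tm n → Tm n → Set
_↠βη_ = Star _⟶βη_

-- lams k t = λ y₁ ⋯ y_k . t   (y_k is de Bruijn index 0)
lams : ∀ {m} (k : ℕ) → Tm (k + m) → Tm m
lams zero    t = t
lams (suc k) t = lams k (ƛ t)

apps : ∀ {m} {n : ℕ} → Tm m → (Fin n → Tm m) → Tm m
apps P Q = foldl _·_ P (tabulate Q)

-- Inside  λ u₁⋯u_n . λ v₁⋯v_n . body  (context n + (n + m)):
--   inner i  is v_{i+1}  (innermost block),  outer i  is u_{i+1}.
inner : ∀ {n m} → Fin n → Tm (n + (n + m))
inner {n} {m} i = var (opposite i ↑ˡ (n + m))

outer : ∀ {n m} → Fin n → Tm (n + (n + m))
outer {n} {m} i = var (n ↑ʳ (opposite i ↑ˡ m))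

-- The terms of the statement.  Indices j, k : Fin n stand for 1,…,n
-- (Fin index j ↦ j+1).

-- M_j^n ≡ λ φ₁⋯φ_n x₁⋯x_n . x_j (φ₁ x₁⋯x_n) ⋯ (φ_n x₁⋯x_n)
Mt : (n : ℕ) → Fin n → Tm 0
Mt n j = lams n (lams n
  (apps (inner {n} {0} j) (λ i → apps (outer {n} {0} i) (λ l → inner {n} {0} l))))

-- A_j ≡ λ x₁⋯x_n . f_j (x₁ x₁⋯x_n) ⋯ (x_n x₁⋯x_n),  under λ f₁⋯f_n
At : (n : ℕ) → Fin n → Tm (n + 0)
At n j = lams n
  (apps (outer {n} {0} j) (λ i → apps (inner {n} {0} i) (λ l → inner {n} {0} l)))

Φ : (n : ℕ) → Fin n → Tm 0
Φ n k = lams n (apps (At n k) (At n))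

-- B_j ≡ λ x₁⋯x_n f₁⋯f_n . f_j (x₁ x₁⋯x_n f₁⋯f_n) ⋯ (x_n x₁⋯x_n f₁⋯f_n)
Bt : (n : ℕ) → Fin n → Tm 0
Bt n j = lams n (lams n
  (apps (inner {n} {0} j)
        (λ i → apps (apps (outer {n} {0} i) (λ l → outer {n} {0} l))
                    (λ l → inner {n} {0} l))))

Ψ : (n : ℕ) → Fin n → Tm 0
Ψ n k = apps (Bt n k) (Bt n)

-- Substituting M⃗ for f⃗ turns A_j into λx⃗. M_j (x₁ x⃗) ⋯ (x_n x⃗). Contracting the
-- n leading abstractions φ⃗ of M_j replaces each φ_i by x_i x⃗, and what remains,
-- λf⃗. f_j (x₁ x⃗ f⃗) ⋯ (x_n x⃗ f⃗) under λx⃗, is exactly B_j. So Φ_k M⃗ β-reduces to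
-- A_k[M⃗/f⃗] A₁[M⃗/f⃗] ⋯ A_n[M⃗/f⃗] and then argumentwise to B_k B₁ ⋯ B_n.
module Submission where

open import Defs
open import Data.Nat using (ℕ; zero; suc; _+_)
open import Data.Fin using (Fin; zero; suc; opposite; _↑ˡ_; _↑ʳ_; fromℕ; inject₁)
open import Data.Fin.Properties using (opposite-involutive)
open import Function using (_∘_; id)
open import Relation.Binary.PropositionalEquality
  using (_≡_; _≗_; refl; sym; trans; cong; cong₂; module ≡-Reasoning)
open import Relation.Binary.Construct.Closure.ReflexiveTransitive using (_◅◅_; gmap)
open import Relation.Binary.Construct.Closure.ReflexiveTransitive.Properties
  using (module StarReasoning)

private
  variable
    m m' m'' : ℕ

ext-cong : {ρ ρ' : Fin m → Fin m'} → ρ ≗ ρ' → ext ρ ≗ ext ρ'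
ext-cong e zero    = refl
ext-cong e (suc i) = cong suc (e i)

rename-cong : {ρ ρ' : Fin m → Fin m'} → ρ ≗ ρ' → rename ρ ≗ rename ρ'
rename-cong e (var i) = cong var (e i)
rename-cong e (ƛ t)   = cong ƛ (rename-cong (ext-cong e) t)
rename-cong e (t · u) = cong₂ _·_ (rename-cong e t) (rename-cong e u)

exts-cong : {σ σ' : Fin m → Tm m'} → σ ≗ σ' → exts σ ≗ exts σ'
exts-cong e zero    = refl
exts-cong e (suc i) = cong (rename suc) (e i)

subst-cong : {σ σ' : Fin m → Tm m'} → σ ≗ σ' → subst σ ≗ subst σ'
subst-cong e (var i) = e i
subst-cong e (ƛ t)   = cong ƛ (subst-cong (exts-cong e) t)
subst-cong e (t · u) = cong₂ _·_ (subst-cong e t) (subst-cong e u)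

rename-id : (t : Tm m) → rename id t ≡ t
rename-id (var i) = refl
rename-id (ƛ t)   =
  cong ƛ (trans (rename-cong (λ { zero → refl ; (suc i) → refl }) t) (rename-id t))
rename-id (t · u) = cong₂ _·_ (rename-id t) (rename-id u)

subst-id : (t : Tm m) → subst var t ≡ t
subst-id (var i) = refl
subst-id (ƛ t)   =
  cong ƛ (trans (subst-cong (λ { zero → refl ; (suc i) → refl }) t) (subst-id t))
subst-id (t · u) = cong₂ _·_ (subst-id t) (subst-id u)

rename≡subst-var : (ρ : Fin m → Fin m') (t : Tm m) → rename ρ t ≡ subst (var ∘ ρ) t
rename≡subst-var ρ (var i) = refl
rename≡subst-var ρ (ƛ t)   = cong ƛ (trans (rename≡subst-var (ext ρ) t)
  (subst-cong (λ { zero → refl ; (suc i) → refl }) t))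
rename≡subst-var ρ (t · u) = cong₂ _·_ (rename≡subst-var ρ t) (rename≡subst-var ρ u)

rename-rename : (ρ₁ : Fin m → Fin m') (ρ₂ : Fin m' → Fin m'') (t : Tm m) →
                rename ρ₂ (rename ρ₁ t) ≡ rename (ρ₂ ∘ ρ₁) t
rename-rename ρ₁ ρ₂ (var i) = refl
rename-rename ρ₁ ρ₂ (ƛ t)   = cong ƛ (trans (rename-rename (ext ρ₁) (ext ρ₂) t)
  (rename-cong (λ { zero → refl ; (suc i) → refl }) t))
rename-rename ρ₁ ρ₂ (t · u) = cong₂ _·_ (rename-rename ρ₁ ρ₂ t) (rename-rename ρ₁ ρ₂ u)

subst-rename : (ρ : Fin m → Fin m') (σ : Fin m' → Tm m'') (t : Tm m) →
               subst σ (rename ρ t) ≡ subst (σ ∘ ρ) t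
subst-rename ρ σ (var i) = refl
subst-rename ρ σ (ƛ t)   = cong ƛ (trans (subst-rename (ext ρ) (exts σ) t)
  (subst-cong (λ { zero → refl ; (suc i) → refl }) t))
subst-rename ρ σ (t · u) = cong₂ _·_ (subst-rename ρ σ t) (subst-rename ρ σ u)

rename-subst : (σ : Fin m → Tm m') (ρ : Fin m' → Fin m'') (t : Tm m) →
               rename ρ (subst σ t) ≡ subst (rename ρ ∘ σ) t
rename-subst σ ρ (var i) = refl
rename-subst σ ρ (ƛ t)   = cong ƛ (trans (rename-subst (exts σ) (ext ρ) t)
  (subst-cong (λ { zero    → refl
                 ; (suc i) → trans (rename-rename suc (ext ρ) (σ i))
                                   (sym (rename-rename ρ suc (σ i))) }) t))
rename-subst σ ρ (t · u) = cong₂ _·_ (rename-subst σ ρ t) (rename-subst σ ρ u)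

subst-subst : (σ₁ : Fin m → Tm m') (σ₂ : Fin m' → Tm m'') (t : Tm m) →
              subst σ₂ (subst σ₁ t) ≡ subst (subst σ₂ ∘ σ₁) t
subst-subst σ₁ σ₂ (var i) = refl
subst-subst σ₁ σ₂ (ƛ t)   = cong ƛ (trans (subst-subst (exts σ₁) (exts σ₂) t)
  (subst-cong (λ { zero    → refl
                 ; (suc i) → trans (subst-rename suc (exts σ₂) (σ₁ i))
                                   (sym (rename-subst σ₂ suc (σ₁ i))) }) t))
subst-subst σ₁ σ₂ (t · u) = cong₂ _·_ (subst-subst σ₁ σ₂ t) (subst-subst σ₁ σ₂ u)

exts⋆ : (k : ℕ) → (Fin m → Tm m') → Fin (k + m) → Tm (k + m')
exts⋆ zero    σ = σ
exts⋆ (suc k) σ = exts (exts⋆ k σ)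

exts⋆-↑ˡ : (k : ℕ) (σ : Fin m → Tm m') (i : Fin k) → exts⋆ k σ (i ↑ˡ m) ≡ var (i ↑ˡ m')
exts⋆-↑ˡ (suc k) σ zero    = refl
exts⋆-↑ˡ (suc k) σ (suc i) = cong (rename suc) (exts⋆-↑ˡ k σ i)

exts⋆-↑ʳ : (k : ℕ) (σ : Fin m → Tm m') (i : Fin m) →
           exts⋆ k σ (k ↑ʳ i) ≡ rename (k ↑ʳ_) (σ i)
exts⋆-↑ʳ zero    σ i = sym (rename-id (σ i))
exts⋆-↑ʳ (suc k) σ i =
  trans (cong (rename suc) (exts⋆-↑ʳ k σ i)) (rename-rename (k ↑ʳ_) suc (σ i))

subst-lams : (k : ℕ) (σ : Fin m → Tm m') (t : Tm (k + m)) →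
             subst σ (lams k t) ≡ lams k (subst (exts⋆ k σ) t)
subst-lams zero    σ t = refl
subst-lams (suc k) σ t = subst-lams k σ (ƛ t)

subst-apps : ∀ {n} (σ : Fin m → Tm m') (P : Tm m) (Q : Fin n → Tm m) →
             subst σ (apps P Q) ≡ apps (subst σ P) (subst σ ∘ Q)
subst-apps {n = zero}  σ P Q = refl
subst-apps {n = suc n} σ P Q = subst-apps σ (P · Q zero) (Q ∘ suc)

apps-cong : ∀ {n} {P P' : Tm m} {Q Q' : Fin n → Tm m} →
            P ≡ P' → Q ≗ Q' → apps P Q ≡ apps P' Q'
apps-cong {n = zero}  eP eQ = eP
apps-cong {n = suc n} eP eQ = apps-cong (cong₂ _·_ eP (eQ zero)) (eQ ∘ suc)

apps-snoc : ∀ {n} (P : Tm m) (Q : Fin (suc n) → Tm m) →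
            apps P Q ≡ apps P (Q ∘ inject₁) · Q (fromℕ n)
apps-snoc {n = zero}  P Q = refl
apps-snoc {n = suc n} P Q = apps-snoc (P · Q zero) (Q ∘ suc)

↠-ƛ : {t t' : Tm (suc m)} → t ↠βη t' → ƛ t ↠βη ƛ t'
↠-ƛ = gmap ƛ ξ-ƛ

↠-·ˡ : {t t' u : Tm m} → t ↠βη t' → t · u ↠βη t' · u
↠-·ˡ {u = u} = gmap (_· u) ξ-·ₗ

↠-·ʳ : {t u u' : Tm m} → u ↠βη u' → t · u ↠βη t · u'
↠-·ʳ {t = t} = gmap (t ·_) ξ-·ᵣ

↠-lams : (k : ℕ) {t t' : Tm (k + m)} → t ↠βη t' → lams k t ↠βη lams k t'
↠-lams zero    r = r
↠-lams (suc k) r = ↠-lams k (↠-ƛ r)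

↠-apps : ∀ {n} {P P' : Tm m} {Q Q' : Fin n → Tm m} →
         P ↠βη P' → (∀ i → Q i ↠βη Q' i) → apps P Q ↠βη apps P' Q'
↠-apps {n = zero}  r rs = r
↠-apps {n = suc n} r rs = ↠-apps (↠-·ˡ r ◅◅ ↠-·ʳ (rs zero)) (rs ∘ suc)

-- The substitution performed by  apps (lams n s) Q : the last argument replaces
-- de Bruijn index 0, so Q i replaces the variable  opposite i ↑ˡ m.
argSubst : (n : ℕ) → (Fin n → Tm m) → Fin (n + m) → Tm m
argSubst zero    Q         = var
argSubst (suc n) Q zero    = Q (fromℕ n)
argSubst (suc n) Q (suc i) = argSubst n (Q ∘ inject₁) i

argSubst-↑ˡ : (n : ℕ) (Q : Fin n → Tm m) (i : Fin n) → argSubst n Q (i ↑ˡ m) ≡ Q (opposite i)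
argSubst-↑ˡ (suc n) Q zero    = refl
argSubst-↑ˡ (suc n) Q (suc i) = argSubst-↑ˡ n (Q ∘ inject₁) i

argSubst-opposite : (n : ℕ) (Q : Fin n → Tm m) (i : Fin n) →
                    argSubst n Q (opposite i ↑ˡ m) ≡ Q i
argSubst-opposite n Q i = trans (argSubst-↑ˡ n Q (opposite i)) (cong Q (opposite-involutive i))

β-lams : (n : ℕ) (s : Tm (n + m)) (Q : Fin n → Tm m) →
         apps (lams n s) Q ↠βη subst (argSubst n Q) s
β-lams zero s Q = begin
  s                  ≡⟨ sym (subst-id s) ⟩
  subst var s        ∎
  where open StarReasoning _⟶βη_
β-lams {m} (suc n) s Q = begin
  apps (lams (suc n) s) Q                          ≡⟨ apps-snoc (lams n (ƛ s)) Q ⟩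
  apps (lams n (ƛ s)) (Q ∘ inject₁) · Q (fromℕ n)  ⟶*⟨ ↠-·ˡ (β-lams n (ƛ s) (Q ∘ inject₁)) ⟩
  ƛ (subst (exts σ) s) · Q (fromℕ n)               ⟶⟨ β _ _ ⟩
  subst (exts σ) s [ Q (fromℕ n) ]                 ≡⟨ trans (subst-subst (exts σ) _ s)
                                                            (subst-cong last-then-σ s) ⟩
  subst (argSubst (suc n) Q) s                     ∎
  where
  open StarReasoning _⟶βη_
  σ : Fin (n + m) → Tm m
  σ = argSubst n (Q ∘ inject₁)
  last-then-σ : ∀ i → exts σ i [ Q (fromℕ n) ] ≡ argSubst (suc n) Q i
  last-then-σ zero    = refl
  last-then-σ (suc i) = trans (subst-rename suc _ (σ i)) (subst-id (σ i))

-- In the bodies of M_j and B_j,  outer  ranges over φ⃗ resp. x⃗ and  inner  over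
-- x⃗ resp. f⃗; under a single block λx⃗ the variable x_i is  x i .
module CurryToTuring (n : ℕ) where

  M⃗ : Fin (n + 0) → Tm 0
  M⃗ = argSubst n (Mt n)

  x : Fin n → Tm (n + 0)
  x i = var (opposite i ↑ˡ 0)

  selfApp : Fin n → Tm (n + 0)
  selfApp i = apps (x i) x

  Mbody : Fin n → Tm (n + (n + 0))
  Mbody j = apps (inner {n} {0} j) (λ i → apps (outer {n} {0} i) (inner {n} {0}))

  Bbody : Fin n → Tm (n + (n + 0))
  Bbody j = apps (inner {n} {0} j)
                 (λ i → apps (apps (outer {n} {0} i) (outer {n} {0})) (inner {n} {0}))

  M⃗⋆ : Fin (n + (n + 0)) → Tm (n + 0)
  M⃗⋆ = exts⋆ n M⃗

  M⃗⋆-outer : ∀ j → M⃗⋆ (n ↑ʳ (opposite j ↑ˡ 0)) ≡ rename (n ↑ʳ_) (Mt n j)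
  M⃗⋆-outer j = trans (exts⋆-↑ʳ n M⃗ (opposite j ↑ˡ 0))
                     (cong (rename (n ↑ʳ_)) (argSubst-opposite n (Mt n) j))

  M⃗⋆-selfApp : ∀ i → subst M⃗⋆ (apps (inner {n} {0} i) (inner {n} {0})) ≡ selfApp i
  M⃗⋆-selfApp i = trans (subst-apps M⃗⋆ (inner {n} {0} i) (inner {n} {0}))
                       (apps-cong (exts⋆-↑ˡ n M⃗ (opposite i)) (exts⋆-↑ˡ n M⃗ ∘ opposite))

  At-M⃗ : ∀ j → subst M⃗ (At n j) ≡ lams n (apps (rename (n ↑ʳ_) (Mt n j)) selfApp)
  At-M⃗ j = trans (subst-lams n M⃗ _) (cong (lams n)
    (trans (subst-apps M⃗⋆ (outer {n} {0} j) (λ i → apps (inner {n} {0} i) (inner {n} {0})))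
           (apps-cong (M⃗⋆-outer j) M⃗⋆-selfApp)))

  weaken : Fin 0 → Tm (n + 0)
  weaken = var ∘ (n ↑ʳ_)

  weaken⋆ : Fin (n + (n + 0)) → Tm (n + (n + (n + 0)))
  weaken⋆ = exts⋆ n (exts⋆ n weaken)

  selfApp⋆ : Fin (n + (n + (n + 0))) → Tm (n + (n + 0))
  selfApp⋆ = exts⋆ n (argSubst n selfApp)

  -- Weakening M_j under λx⃗ and then contracting its φ⃗ against x₁ x⃗, …, x_n x⃗
  -- acts on the body of M_j as φ_i ↦ x_i x⃗, x_i ↦ f_i.
  φ≔selfApp : Fin (n + (n + 0)) → Tm (n + (n + 0))
  φ≔selfApp = subst selfApp⋆ ∘ weaken⋆

  φ≔selfApp-inner : ∀ i → φ≔selfApp (opposite i ↑ˡ (n + 0)) ≡ inner {n} {0} i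
  φ≔selfApp-inner i = trans (cong (subst selfApp⋆) (exts⋆-↑ˡ n (exts⋆ n weaken) (opposite i)))
                            (exts⋆-↑ˡ n (argSubst n selfApp) (opposite i))

  φ≔selfApp-outer : ∀ i →
                    φ≔selfApp (n ↑ʳ (opposite i ↑ˡ 0)) ≡ apps (outer {n} {0} i) (outer {n} {0})
  φ≔selfApp-outer i = begin
    subst selfApp⋆ (weaken⋆ (n ↑ʳ (opposite i ↑ˡ 0)))
      ≡⟨ cong (subst selfApp⋆) (trans (exts⋆-↑ʳ n (exts⋆ n weaken) (opposite i ↑ˡ 0))
                                      (cong (rename (n ↑ʳ_)) (exts⋆-↑ˡ n weaken (opposite i)))) ⟩
    selfApp⋆ (n ↑ʳ (opposite i ↑ˡ (n + 0)))
      ≡⟨ exts⋆-↑ʳ n (argSubst n selfApp) (opposite i ↑ˡ (n + 0)) ⟩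
    rename (n ↑ʳ_) (argSubst n selfApp (opposite i ↑ˡ (n + 0)))
      ≡⟨ cong (rename (n ↑ʳ_)) (argSubst-opposite n selfApp i) ⟩
    rename (n ↑ʳ_) (selfApp i)
      ≡⟨ rename≡subst-var (n ↑ʳ_) (selfApp i) ⟩
    subst (var ∘ (n ↑ʳ_)) (selfApp i)
      ≡⟨ subst-apps _ (x i) x ⟩
    apps (outer {n} {0} i) (outer {n} {0})
      ∎
    where open ≡-Reasoning

  φ≔selfApp-Mbody : ∀ j → subst φ≔selfApp (Mbody j) ≡ Bbody j
  φ≔selfApp-Mbody j =
    trans (subst-apps φ≔selfApp (inner {n} {0} j) (λ i → apps (outer {n} {0} i) (inner {n} {0})))
          (apps-cong (φ≔selfApp-inner j) λ i →
            trans (subst-apps φ≔selfApp (outer {n} {0} i) (inner {n} {0}))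
                  (apps-cong (φ≔selfApp-outer i) φ≔selfApp-inner))

  weaken-Mt : ∀ j → rename (n ↑ʳ_) (Mt n j) ≡ lams n (lams n (subst weaken⋆ (Mbody j)))
  weaken-Mt j = begin
    rename (n ↑ʳ_) (Mt n j)
      ≡⟨ rename≡subst-var (n ↑ʳ_) (Mt n j) ⟩
    subst weaken (lams n (lams n (Mbody j)))
      ≡⟨ subst-lams n weaken _ ⟩
    lams n (subst (exts⋆ n weaken) (lams n (Mbody j)))
      ≡⟨ cong (lams n) (subst-lams n (exts⋆ n weaken) (Mbody j)) ⟩
    lams n (lams n (subst weaken⋆ (Mbody j)))
      ∎
    where open ≡-Reasoning

  weaken-Mt-selfApp : ∀ j → apps (rename (n ↑ʳ_) (Mt n j)) selfApp ↠βη lams n (Bbody j)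
  weaken-Mt-selfApp j = begin
    apps (rename (n ↑ʳ_) (Mt n j)) selfApp
      ≡⟨ cong (λ t → apps t selfApp) (weaken-Mt j) ⟩
    apps (lams n (lams n (subst weaken⋆ (Mbody j)))) selfApp
      ⟶*⟨ β-lams n _ selfApp ⟩
    subst (argSubst n selfApp) (lams n (subst weaken⋆ (Mbody j)))
      ≡⟨ subst-lams n _ _ ⟩
    lams n (subst selfApp⋆ (subst weaken⋆ (Mbody j)))
      ≡⟨ cong (lams n) (subst-subst weaken⋆ selfApp⋆ (Mbody j)) ⟩
    lams n (subst φ≔selfApp (Mbody j))
      ≡⟨ cong (lams n) (φ≔selfApp-Mbody j) ⟩
    lams n (Bbody j)
      ∎
    where open StarReasoning _⟶βη_

  At-M⃗-↠-Bt : ∀ j → subst M⃗ (At n j) ↠βη Bt n j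
  At-M⃗-↠-Bt j = begin
    subst M⃗ (At n j)                                          ≡⟨ At-M⃗ j ⟩
    lams n (apps (rename (n ↑ʳ_) (Mt n j)) selfApp)           ⟶*⟨ ↠-lams n (weaken-Mt-selfApp j) ⟩
    Bt n j                                                    ∎
    where open StarReasoning _⟶βη_

proposition5p1 : (n : ℕ) (k : Fin n) → apps (Φ n k) (Mt n) ↠βη Ψ n k
proposition5p1 n k = begin
  apps (Φ n k) (Mt n)                           ⟶*⟨ β-lams n _ (Mt n) ⟩
  subst M⃗ (apps (At n k) (At n))                ≡⟨ subst-apps M⃗ (At n k) (At n) ⟩
  apps (subst M⃗ (At n k)) (subst M⃗ ∘ At n)      ⟶*⟨ ↠-apps (At-M⃗-↠-Bt k) At-M⃗-↠-Bt ⟩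
  Ψ n k                                         ∎
  where
  open CurryToTuring n
  open StarReasoning _⟶βη_
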